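{- The following hold: (a) $\rho_{\mathrm{opt}}(K_n)=2$ for $n\ge2$, where $K_n$ is the complete graph on $n$ vertices; (b) $\rho_{\mathrm{opt}}(W_n)=2$ for $n\ge4$, where $W_n$ is the wheel with $n$ spikes; (c) $\rho_{\mathrm{opt}}(K_{m,n})=3$ for $m,n\ge3$, where $K_{m,n}$ is the complete bipartite graph; (d) $\rho_{\mathrm{opt}}(P)=4$, where $P$ is the Petersen graph.
   Context: A pebble distribution on a graph $G$ is a function $p:V(G)\to\mathbb{Z}_{\ge0}$, its size is $\sum_v p(v)$. If $\{v,u\}\in E(G)$, the pebbling move $(v,v\to u)$ removes two pebbles at $v$ and adds one at $u$. If $v\ne w$ and $\{v,u\},\{w,u\}\in E(G)$, the strict rubbling move $(v,w\to u)$ removes one pebble at each of $v$ and $w$ and adds one at $u$. A rubbling move is either of these. A vertex $x$ is reachable from $p$ if there is a sequence of rubbling moves, with pebble counts never becoming negative, after which $x$ has at least one pebble. The optimal rubbling number $\rho_{\mathrm{opt}}(G)$ is the minimum $m$ for which there exists a pebble distribution of size $m$ from which every vertex of $G$ is reachable. The wheel $W_n$ with $n$ spikes consists of a cycle $C_n$ together with a center vertex adjacent to all $n$ cycle vertices. -}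

module Defs where

open import Data.Nat using (ℕ; zero; suc; _+_; _∸_; _≤_; _<_)
open import Data.Fin using (Fin; toℕ; _≟_)
import Data.Fin as F
open import Data.Product using (Σ; ∃; _×_; _,_)
open import Data.Sum using (_⊎_)
open import Data.Empty using (⊥)
open import Data.Unit using (⊤)
open import Data.List using (List; []; _∷_)
open import Data.List.Membership.Propositional using (_∈_)
open import Relation.Nullary using (¬_; yes; no)
open import Relation.Binary.PropositionalEquality using (_≡_; _≢_)
open import Relation.Binary.Construct.Closure.ReflexiveTransitive using (Star)

-- A (simple, undirected) graph on vertex set Fin n, given by its adjacency relation.
-- (All concrete graphs below have symmetric, irreflexive adjacency.)
record Graph : Set₁ where
  field
    order : ℕ
    Adj   : Fin order → Fin order → Set
open Graph public

Dist : Graph → Set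
Dist G = Fin (order G) → ℕ

size : ∀ {n} → (Fin n → ℕ) → ℕ
size {zero}  p = 0
size {suc n} p = p F.zero + size (λ i → p (F.suc i))

dec1 : ∀ {n} → Fin n → (Fin n → ℕ) → (Fin n → ℕ)
dec1 v p x with x ≟ v
... | yes _ = p x ∸ 1
... | no  _ = p x

inc1 : ∀ {n} → Fin n → (Fin n → ℕ) → (Fin n → ℕ)
inc1 u p x with x ≟ u
... | yes _ = suc (p x)
... | no  _ = p x

-- One rubbling move (pebbling move or strict rubbling move); the side
-- conditions guarantee pebble counts never become negative.
data Step (G : Graph) : Dist G → Dist G → Set where
  pebbling : ∀ {p : Dist G} (v u : Fin (order G)) →
    Adj G v u → 2 ≤ p v → Step G p (inc1 u (dec1 v (dec1 v p)))
  strict   : ∀ {p : Dist G} (v w u : Fin (order G)) → v ≢ w →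
    Adj G v u → Adj G w u → 1 ≤ p v → 1 ≤ p w →
    Step G p (inc1 u (dec1 w (dec1 v p)))

Reachable : (G : Graph) → Dist G → Fin (order G) → Set
Reachable G p x = Σ (Dist G) λ q → Star (Step G) p q × 1 ≤ q x

Solvable : (G : Graph) → Dist G → Set
Solvable G p = ∀ x → Reachable G p x

OptRubblingNumber : Graph → ℕ → Set
OptRubblingNumber G m =
  (Σ (Dist G) λ p → size p ≡ m × Solvable G p) ×
  (∀ (p : Dist G) → size p < m → ¬ Solvable G p)

complete : ℕ → Graph
complete n = record { order = n ; Adj = λ i j → i ≢ j }

CycSucc : (n : ℕ) → Fin n → Fin n → Set
CycSucc n i j = suc (toℕ i) ≡ toℕ j ⊎ (suc (toℕ i) ≡ n × toℕ j ≡ 0)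

-- Wheel W_n: vertex 0 is the center, vertices suc i (i : Fin n) form the cycle C_n
wheelAdj : (n : ℕ) → Fin (suc n) → Fin (suc n) → Set
wheelAdj n F.zero    F.zero    = ⊥
wheelAdj n F.zero    (F.suc j) = ⊤
wheelAdj n (F.suc i) F.zero    = ⊤
wheelAdj n (F.suc i) (F.suc j) = CycSucc n i j ⊎ CycSucc n j i

wheel : ℕ → Graph
wheel n = record { order = suc n ; Adj = wheelAdj n }

completeBipartite : ℕ → ℕ → Graph
completeBipartite m n = record
  { order = m + n
  ; Adj = λ i j → (toℕ i < m × m ≤ toℕ j) ⊎ (m ≤ toℕ i × toℕ j < m) }

-- Petersen graph: outer 5-cycle 0..4, spokes i–(i+5), inner pentagram 5–7–9–6–8–5
petersenEdges : List (ℕ × ℕ)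
petersenEdges =
  (0 , 1) ∷ (1 , 2) ∷ (2 , 3) ∷ (3 , 4) ∷ (4 , 0) ∷
  (0 , 5) ∷ (1 , 6) ∷ (2 , 7) ∷ (3 , 8) ∷ (4 , 9) ∷
  (5 , 7) ∷ (7 , 9) ∷ (9 , 6) ∷ (6 , 8) ∷ (8 , 5) ∷ []

petersen : Graph
petersen = record
  { order = 10
  ; Adj = λ i j → ((toℕ i , toℕ j) ∈ petersenEdges) ⊎ ((toℕ j , toℕ i) ∈ petersenEdges) }

-- Every rubbling move consumes two pebbles and produces one, so a distribution of
-- size at most two allows at most one move, after which nothing moves.  Hence one
-- pebble reaches only its own vertex, and with two pebbles an empty vertex is
-- reached only if it has two pebbles on its neighbours.  In K_n and W_n a vertex
-- adjacent to all others solves with two pebbles piled on it.  In K_{m,n} with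
-- two pebbles some vertex on each side is empty, and reaching both would need two
-- pebbles on each side; conversely two pebbles on one side plus one on the other
-- reach everything.  For the Petersen graph four pebbles on one vertex suffice
-- since its diameter is two, and every distribution of at most three pebbles is
-- refuted by exhaustive search: reachability from a distribution of size k is
-- decided by searching moves to depth k.
module Submission where

open import Defs
open import Data.Nat using (ℕ; zero; suc; _+_; _∸_; _≤_; _<_; z≤n; s≤s; s≤s⁻¹; _≤?_; _<?_)
import Data.Nat as ℕ
open import Data.Nat.Properties
  using (≤-refl; ≤-trans; ≤-reflexive; <⇒≱; ≮⇒≥; +-suc; m≤m+n; m∸n≤m; m+n∸m≡n; m+[n∸m]≡n; m≤o∸n⇒m+n≤o; ∸-monoˡ-≤)
open import Data.Fin using (Fin; zero; suc; toℕ; _≟_; _↑ʳ_; fromℕ<)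
open import Data.Fin.Properties using (toℕ-↑ʳ; ↑ʳ-injective; toℕ-fromℕ<)
open import Data.Vec.Functional using ([]; _∷_; head; tail)
open import Data.Product using (Σ; _×_; _,_; proj₁; proj₂; ∃-syntax)
open import Data.Product.Properties using (≡-dec)
open import Data.Sum using (_⊎_; inj₁; inj₂; [_,_])
open import Data.Unit using (tt)
open import Data.Bool using (Bool; true; false; T; not; _∧_; _∨_)
open import Data.Bool.Properties using (T-∧; T-∨; T-≡; T-not-≡)
open import Function using (_∘_)
open import Function.Bundles using (module Equivalence)
open Equivalence using (to; from)
open import Relation.Nullary using (¬_; Dec; yes; no; contradiction)
open import Relation.Nullary.Decidable using (⌊_⌋; _⊎-dec_; toWitness; fromWitness)
open import Relation.Unary using (Pred)
open import Relation.Binary.Definitions using (Decidable)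
open import Relation.Binary.PropositionalEquality
  using (_≡_; _≢_; refl; sym; trans; cong; cong₂; subst; _≗_; ≢-sym; module ≡-Reasoning)
open import Relation.Binary.Construct.Closure.ReflexiveTransitive using (Star; ε; _◅_)

private
  variable
    n k : ℕ
    G : Graph

inc1-updates : (u : Fin n) (p : Fin n → ℕ) → inc1 u p u ≡ suc (p u)
inc1-updates u p with u ≟ u
... | yes _  = refl
... | no u≢u = contradiction refl u≢u

inc1-minimal : (u x : Fin n) (p : Fin n → ℕ) → x ≢ u → inc1 u p x ≡ p x
inc1-minimal u x p x≢u with x ≟ u
... | yes x≡u = contradiction x≡u x≢u
... | no _    = refl

dec1-updates : (v : Fin n) (p : Fin n → ℕ) → dec1 v p v ≡ p v ∸ 1
dec1-updates v p with v ≟ v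
... | yes _  = refl
... | no v≢v = contradiction refl v≢v

dec1-minimal : (v x : Fin n) (p : Fin n → ℕ) → x ≢ v → dec1 v p x ≡ p x
dec1-minimal v x p x≢v with x ≟ v
... | yes x≡v = contradiction x≡v x≢v
... | no _    = refl

dec1-≤ : (v x : Fin n) (p : Fin n → ℕ) → dec1 v p x ≤ p x
dec1-≤ v x p with x ≟ v
... | yes _ = m∸n≤m (p x) 1
... | no _  = ≤-refl

inc1-cong : (u : Fin n) {p q : Fin n → ℕ} → p ≗ q → inc1 u p ≗ inc1 u q
inc1-cong u p≗q x with x ≟ u
... | yes _ = cong suc (p≗q x)
... | no _  = p≗q x

dec1-cong : (v : Fin n) {p q : Fin n → ℕ} → p ≗ q → dec1 v p ≗ dec1 v q
dec1-cong v p≗q x with x ≟ v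
... | yes _ = cong (_∸ 1) (p≗q x)
... | no _  = p≗q x

inc1-tail : (u : Fin n) (p : Fin (suc n) → ℕ) → tail (inc1 (suc u) p) ≗ inc1 u (tail p)
inc1-tail u p i with i ≟ u
... | yes _ = refl
... | no _  = refl

dec1-tail : (v : Fin n) (p : Fin (suc n) → ℕ) → tail (dec1 (suc v) p) ≗ dec1 v (tail p)
dec1-tail v p i with i ≟ v
... | yes _ = refl
... | no _  = refl

inc1-occupied : (u : Fin n) (p : Fin n → ℕ) → 1 ≤ inc1 u p u
inc1-occupied u p = subst (1 ≤_) (sym (inc1-updates u p)) (s≤s z≤n)

dec1-occupied-self : (v : Fin n) (p : Fin n → ℕ) → 2 ≤ p v → 1 ≤ dec1 v p v
dec1-occupied-self v p 2≤pv = subst (1 ≤_) (sym (dec1-updates v p)) (∸-monoˡ-≤ 1 2≤pv)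

dec1-occupied-other : (v x : Fin n) (p : Fin n → ℕ) → x ≢ v → 1 ≤ p x → 1 ≤ dec1 v p x
dec1-occupied-other v x p x≢v = subst (1 ≤_) (sym (dec1-minimal v x p x≢v))

size-cong : {p q : Fin n → ℕ} → p ≗ q → size p ≡ size q
size-cong {zero}  p≗q = refl
size-cong {suc n} p≗q = cong₂ _+_ (p≗q zero) (size-cong (p≗q ∘ suc))

size-inc1 : (u : Fin n) (p : Fin n → ℕ) → size (inc1 u p) ≡ suc (size p)
size-inc1 zero p =
  cong₂ _+_ (inc1-updates zero p) (size-cong λ i → inc1-minimal zero (suc i) p λ ())
size-inc1 (suc u) p = begin
  inc1 (suc u) p zero + size (tail (inc1 (suc u) p))
    ≡⟨ cong₂ _+_ (inc1-minimal (suc u) zero p λ ()) (size-cong (inc1-tail u p)) ⟩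
  p zero + size (inc1 u (tail p))   ≡⟨ cong (p zero +_) (size-inc1 u (tail p)) ⟩
  p zero + suc (size (tail p))      ≡⟨ +-suc (p zero) _ ⟩
  suc (size p)                      ∎
  where open ≡-Reasoning

size-dec1 : (v : Fin n) (p : Fin n → ℕ) → 1 ≤ p v → size p ≡ suc (size (dec1 v p))
size-dec1 zero p 1≤p0 = sym (begin
  suc (dec1 zero p zero + size (tail (dec1 zero p)))
    ≡⟨ cong₂ (λ a b → suc (a + b)) (dec1-updates zero p)
             (size-cong λ i → dec1-minimal zero (suc i) p λ ()) ⟩
  suc (p zero ∸ 1) + size (tail p)  ≡⟨ cong (_+ size (tail p)) (m+[n∸m]≡n 1≤p0) ⟩
  size p                            ∎)
  where open ≡-Reasoning
size-dec1 (suc v) p 1≤pv = begin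
  p zero + size (tail p)                 ≡⟨ cong (p zero +_) (size-dec1 v (tail p) 1≤pv) ⟩
  p zero + suc (size (dec1 v (tail p)))  ≡⟨ +-suc (p zero) _ ⟩
  suc (p zero + size (dec1 v (tail p)))
    ≡⟨ cong suc (sym (cong₂ _+_ (dec1-minimal (suc v) zero p λ ()) (size-cong (dec1-tail v p)))) ⟩
  suc (size (dec1 (suc v) p))            ∎
  where open ≡-Reasoning

size-≥1 : (v : Fin n) (p : Fin n → ℕ) → 1 ≤ p v → 1 ≤ size p
size-≥1 v p pv rewrite size-dec1 v p pv = s≤s z≤n

size-≥2 : (v w : Fin n) (p : Fin n → ℕ) → 1 ≤ p v → 1 ≤ dec1 v p w → 2 ≤ size p
size-≥2 v w p pv pw rewrite size-dec1 v p pv = s≤s (size-≥1 w (dec1 v p) pw)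

size-≥3 : (u v w : Fin n) (p : Fin n → ℕ) →
          1 ≤ p u → 1 ≤ dec1 u p v → 1 ≤ dec1 v (dec1 u p) w → 3 ≤ size p
size-≥3 u v w p pu pv pw rewrite size-dec1 u p pu = s≤s (size-≥2 v w (dec1 u p) pv pw)

unoccupied-among-three : (a b c : Fin n) (p : Fin n → ℕ) → size p ≤ 2 →
                         a ≢ b → a ≢ c → b ≢ c → ∀ {ℓ} (P : Pred (Fin n) ℓ) →
                         P a → P b → P c → ∃[ x ] (P x × ¬ 1 ≤ p x)
unoccupied-among-three a b c p size≤2 a≢b a≢c b≢c P Pa Pb Pc
  with 1 ≤? p a | 1 ≤? p b | 1 ≤? p c
... | no pa  | _      | _      = a , Pa , pa
... | yes _  | no pb  | _      = b , Pb , pb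
... | yes _  | yes _  | no pc  = c , Pc , pc
... | yes pa | yes pb | yes pc = contradiction
      (size-≥3 a b c p pa (dec1-occupied-other a b p (≢-sym a≢b) pb)
         (dec1-occupied-other b c _ (≢-sym b≢c) (dec1-occupied-other a c p (≢-sym a≢c) pc)))
      (<⇒≱ (s≤s size≤2))

pile : Fin n → ℕ → Fin n → ℕ
pile c zero    = λ _ → 0
pile c (suc k) = inc1 c (pile c k)

pile-at : (c : Fin n) (k : ℕ) → pile c k c ≡ k
pile-at c zero    = refl
pile-at c (suc k) = trans (inc1-updates c _) (cong suc (pile-at c k))

size-pile : (c : Fin n) (k : ℕ) → size (pile c k) ≡ k
size-pile {n} c zero = size-empty n
  where
  size-empty : ∀ n → size {n} (λ _ → 0) ≡ 0
  size-empty zero    = refl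
  size-empty (suc n) = size-empty n
size-pile c (suc k) = trans (size-inc1 c _) (cong suc (size-pile c k))

-- A pebble is taken from v, then one from w, and one is put on u; v = w is a
-- pebbling move.
record Move (G : Graph) (p : Dist G) (u : Fin (order G)) : Set where
  constructor move
  field
    v w        : Fin (order G)
    v~u        : Adj G v u
    w~u        : Adj G w u
    v-occupied : 1 ≤ p v
    w-occupied : 1 ≤ dec1 v p w

after : {p : Dist G} {u : Fin (order G)} → Move G p u → Dist G
after {p = p} {u} m = inc1 u (dec1 (Move.w m) (dec1 (Move.v m) p))

move-step : {p : Dist G} {u : Fin (order G)} (m : Move G p u) → Step G p (after m)
move-step {p = p} {u} (move v w v~u w~u pv pw) with v ≟ w
... | yes refl = pebbling v u v~u (m≤o∸n⇒m+n≤o 1 pv (subst (1 ≤_) (dec1-updates v p) pw))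
... | no v≢w   = strict v w u v≢w v~u w~u pv (subst (1 ≤_) (dec1-minimal v w p (≢-sym v≢w)) pw)

step-move : {p q : Dist G} → Step G p q → ∃[ u ] Σ (Move G p u) λ m → after m ≡ q
step-move {p = p} (pebbling v u v~u 2≤pv) =
  u , move v v v~u v~u (≤-trans (s≤s z≤n) 2≤pv) (dec1-occupied-self v p 2≤pv) , refl
step-move {p = p} (strict v w u v≢w v~u w~u pv pw) =
  u , move v w v~u w~u pv (dec1-occupied-other v w p (≢-sym v≢w) pw) , refl

Move-size≥2 : {p : Dist G} {u : Fin (order G)} → Move G p u → 2 ≤ size p
Move-size≥2 {p = p} (move v w _ _ pv pw) = size-≥2 v w p pv pw

size-after : {p : Dist G} {u : Fin (order G)} (m : Move G p u) → size p ≡ suc (size (after m))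
size-after {p = p} {u} (move v w _ _ pv pw) = begin
  size p                                ≡⟨ size-dec1 v p pv ⟩
  suc (size (dec1 v p))                 ≡⟨ cong suc (size-dec1 w (dec1 v p) pw) ⟩
  suc (suc (size (dec1 w (dec1 v p))))  ≡⟨ cong suc (sym (size-inc1 u _)) ⟩
  suc (size (inc1 u (dec1 w (dec1 v p)))) ∎
  where open ≡-Reasoning

after-occupied : {p : Dist G} {u : Fin (order G)} (m : Move G p u) (x : Fin (order G)) →
                 1 ≤ after m x → 1 ≤ p x ⊎ u ≡ x
after-occupied {p = p} {u} (move v w _ _ _ _) x 1≤x with x ≟ u
... | yes x≡u = inj₂ (sym x≡u)
... | no _    = inj₁ (≤-trans 1≤x (≤-trans (dec1-≤ w x _) (dec1-≤ v x p)))

step-size≤ : {p q : Dist G} → Step G p q → size p ≤ suc k → size q ≤ k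
step-size≤ step size≤ with step-move step
... | _ , m , refl = s≤s⁻¹ (subst (_≤ suc _) (size-after m) size≤)

stuck : {p q : Dist G} → size p ≤ 1 → Star (Step G) p q → q ≡ p
stuck size≤1 ε = refl
stuck size≤1 (step ◅ _) with step-move step
... | _ , m , _ = contradiction (Move-size≥2 m) (<⇒≱ (s≤s size≤1))

reachable-size≤2 : {p : Dist G} {x : Fin (order G)} → size p ≤ 2 →
                   Reachable G p x → 1 ≤ p x ⊎ Move G p x
reachable-size≤2 _ (_ , ε , 1≤qx) = inj₁ 1≤qx
reachable-size≤2 {x = x} size≤2 (_ , step ◅ steps , 1≤qx) with step-move step
... | _ , m , refl
    with after-occupied m x (subst (λ r → 1 ≤ r x) (stuck (step-size≤ step size≤2) steps) 1≤qx)
...   | inj₁ 1≤px = inj₁ 1≤px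
...   | inj₂ refl = inj₂ m

size≤1⇒unsolvable : {a b : Fin (order G)} → a ≢ b → (p : Dist G) → size p ≤ 1 → ¬ Solvable G p
size≤1⇒unsolvable {a = a} {b} a≢b p size≤1 solvable =
  <⇒≱ (s≤s size≤1) (size-≥2 a b p (occupied a) (dec1-occupied-other a b p (≢-sym a≢b) (occupied b)))
  where
  occupied : ∀ x → 1 ≤ p x
  occupied x with solvable x
  ... | _ , steps , 1≤qx = subst (λ r → 1 ≤ r x) (stuck size≤1 steps) 1≤qx

dominating-solvable : (c : Fin (order G)) → (∀ x → x ≢ c → Adj G c x) → Solvable G (pile c 2)
dominating-solvable c c~ x with x ≟ c
... | yes refl = pile c 2 , ε , subst (1 ≤_) (sym (pile-at c 2)) (s≤s z≤n)
... | no x≢c   = _ , pebbling c x (c~ x x≢c) (≤-reflexive (sym (pile-at c 2))) ◅ ε , inc1-occupied x _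

optRubbling-dominating : (c d : Fin (order G)) → c ≢ d → (∀ x → x ≢ c → Adj G c x) →
                         OptRubblingNumber G 2
optRubbling-dominating c d c≢d c~ =
  (pile c 2 , size-pile c 2 , dominating-solvable c c~) ,
  λ p size<2 → size≤1⇒unsolvable c≢d p (s≤s⁻¹ size<2)

optRubbling-complete : ∀ n → 2 ≤ n → OptRubblingNumber (complete n) 2
optRubbling-complete (suc (suc n)) (s≤s (s≤s _)) =
  optRubbling-dominating zero (suc zero) (λ ()) λ _ → ≢-sym

optRubbling-wheel : ∀ n → 1 ≤ n → OptRubblingNumber (wheel n) 2
optRubbling-wheel (suc n) _ = optRubbling-dominating zero (suc zero) (λ ()) hub~
  where
  hub~ : ∀ x → x ≢ zero → Adj (wheel (suc n)) zero x
  hub~ zero    x≢0 = contradiction refl x≢0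
  hub~ (suc x) _   = tt

module _ {m n : ℕ} where

  private
    K = completeBipartite m n

  left-neighbour : {v x : Fin (m + n)} → Adj K v x → toℕ x < m → m ≤ toℕ v
  left-neighbour (inj₁ (_ , m≤x)) x<m = contradiction m≤x (<⇒≱ x<m)
  left-neighbour (inj₂ (m≤v , _)) _   = m≤v

  right-neighbour : {v x : Fin (m + n)} → Adj K v x → m ≤ toℕ x → toℕ v < m
  right-neighbour (inj₁ (v<m , _)) _   = v<m
  right-neighbour (inj₂ (_ , x<m)) m≤x = contradiction m≤x (<⇒≱ x<m)

  left≢right : {a b : Fin (m + n)} → toℕ a < m → m ≤ toℕ b → a ≢ b
  left≢right a<m m≤a refl = <⇒≱ a<m m≤a

  completeBipartite-solvable : {a b : Fin (m + n)} → toℕ a < m → m ≤ toℕ b →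
                               Solvable K (inc1 b (pile a 2))
  completeBipartite-solvable {a} {b} a<m m≤b x = reach (toℕ x <? m)
    where
    b≢a : b ≢ a
    b≢a = ≢-sym (left≢right a<m m≤b)

    two-at-a : 2 ≤ inc1 b (pile a 2) a
    two-at-a = ≤-reflexive (sym (trans (inc1-minimal b a _ (left≢right a<m m≤b)) (pile-at a 2)))

    two-at-b : 2 ≤ inc1 b (dec1 a (dec1 a (inc1 b (pile a 2)))) b
    two-at-b = subst (2 ≤_) (sym (begin
      inc1 b (dec1 a (dec1 a (inc1 b (pile a 2)))) b  ≡⟨ inc1-updates b _ ⟩
      suc (dec1 a (dec1 a (inc1 b (pile a 2))) b)     ≡⟨ cong suc (dec1-minimal a b _ b≢a) ⟩
      suc (dec1 a (inc1 b (pile a 2)) b)              ≡⟨ cong suc (dec1-minimal a b _ b≢a) ⟩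
      suc (inc1 b (pile a 2) b)                       ≡⟨ cong suc (inc1-updates b _) ⟩
      suc (suc (pile a 2 b))                          ∎)) (s≤s (s≤s z≤n))
      where open ≡-Reasoning

    reach : Dec (toℕ x < m) → Reachable K (inc1 b (pile a 2)) x
    reach (no x≮m) = _ , pebbling a x (inj₁ (a<m , ≮⇒≥ x≮m)) two-at-a ◅ ε , inc1-occupied x _
    reach (yes x<m) =
      _ , pebbling a b (inj₁ (a<m , m≤b)) two-at-a ◅ pebbling b x (inj₂ (m≤b , x<m)) two-at-b ◅ ε ,
      inc1-occupied x _

  completeBipartite-unsolvable : {x y : Fin (m + n)} → toℕ x < m → m ≤ toℕ y →
                                 (p : Dist K) → size p ≤ 2 → ¬ 1 ≤ p x → ¬ 1 ≤ p y → ¬ Solvable K p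
  completeBipartite-unsolvable x<m m≤y p size≤2 x-empty y-empty solvable
    with reachable-size≤2 size≤2 (solvable _) | reachable-size≤2 size≤2 (solvable _)
  ... | inj₁ px | _ = x-empty px
  ... | _ | inj₁ py = y-empty py
  ... | inj₂ (move v w v~x w~x pv pw) | inj₂ (move u _ u~y _ pu _) =
        <⇒≱ (s≤s size≤2) (size-≥3 v w u p pv pw
          (dec1-occupied-other w u _ (u≢ w~x) (dec1-occupied-other v u p (u≢ v~x) pu)))
    where
    u≢ : ∀ {t} → Adj K t _ → u ≢ t
    u≢ t~x = left≢right (right-neighbour u~y m≤y) (left-neighbour t~x x<m)

optRubbling-completeBipartite : ∀ m n → OptRubblingNumber (completeBipartite (3 + m) (3 + n)) 3
optRubbling-completeBipartite m n =
  (inc1 (right zero) (pile zero 2) ,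
   trans (size-inc1 (right zero) (pile zero 2)) (cong suc (size-pile {n = 3 + m + (3 + n)} zero 2)) ,
   completeBipartite-solvable (s≤s z≤n) (right-right zero)) ,
  unsolvable
  where
  right : Fin (3 + n) → Fin (3 + m + (3 + n))
  right j = (3 + m) ↑ʳ j

  right-right : ∀ j → 3 + m ≤ toℕ (right j)
  right-right j = subst (3 + m ≤_) (sym (toℕ-↑ʳ (3 + m) j)) (m≤m+n _ _)

  right-≢ : ∀ {i j} → i ≢ j → right i ≢ right j
  right-≢ i≢j = i≢j ∘ ↑ʳ-injective (3 + m) _ _

  unsolvable : ∀ p → size p < 3 → ¬ Solvable (completeBipartite (3 + m) (3 + n)) p
  unsolvable p (s≤s size≤2)
    with unoccupied-among-three zero (suc zero) (suc (suc zero)) p size≤2 (λ ()) (λ ()) (λ ())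
           (λ x → toℕ x < 3 + m) (s≤s z≤n) (s≤s (s≤s z≤n)) (s≤s (s≤s (s≤s z≤n)))
       | unoccupied-among-three (right zero) (right (suc zero)) (right (suc (suc zero))) p size≤2
           (right-≢ λ ()) (right-≢ λ ()) (right-≢ λ ())
           (λ y → 3 + m ≤ toℕ y) (right-right _) (right-right _) (right-right _)
  ... | _ , x-left , x-empty | _ , y-right , y-empty =
    completeBipartite-unsolvable x-left y-right p size≤2 x-empty y-empty

step-resp-≗ : {p p′ q : Dist G} → p ≗ p′ → Step G p q → ∃[ q′ ] (Step G p′ q′ × q ≗ q′)
step-resp-≗ p≗p′ (pebbling v u v~u 2≤pv) =
  _ , pebbling v u v~u (subst (2 ≤_) (p≗p′ v) 2≤pv) , inc1-cong u (dec1-cong v (dec1-cong v p≗p′))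
step-resp-≗ p≗p′ (strict v w u v≢w v~u w~u pv pw) =
  _ , strict v w u v≢w v~u w~u (subst (1 ≤_) (p≗p′ v) pv) (subst (1 ≤_) (p≗p′ w) pw) ,
  inc1-cong u (dec1-cong w (dec1-cong v p≗p′))

steps-resp-≗ : {p p′ q : Dist G} → p ≗ p′ → Star (Step G) p q → ∃[ q′ ] (Star (Step G) p′ q′ × q ≗ q′)
steps-resp-≗ p≗p′ ε = _ , ε , p≗p′
steps-resp-≗ p≗p′ (step ◅ steps) with step-resp-≗ p≗p′ step
... | _ , step′ , q≗q′ with steps-resp-≗ q≗q′ steps
...   | r′ , steps′ , r≗r′ = r′ , step′ ◅ steps′ , r≗r′

reachable-resp-≗ : {p p′ : Dist G} {x : Fin (order G)} → p ≗ p′ → Reachable G p x → Reachable G p′ x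
reachable-resp-≗ {x = x} p≗p′ (_ , steps , 1≤rx) with steps-resp-≗ p≗p′ steps
... | r′ , steps′ , r≗r′ = r′ , steps′ , subst (1 ≤_) (r≗r′ x) 1≤rx

solvable-resp-≗ : {p p′ : Dist G} → p ≗ p′ → Solvable G p → Solvable G p′
solvable-resp-≗ p≗p′ solvable x = reachable-resp-≗ p≗p′ (solvable x)

anyᶠ : (Fin n → Bool) → Bool
anyᶠ {zero}  f = false
anyᶠ {suc n} f = f zero ∨ anyᶠ (f ∘ suc)

allᶠ : (Fin n → Bool) → Bool
allᶠ {zero}  f = true
allᶠ {suc n} f = f zero ∧ allᶠ (f ∘ suc)

anyᶠ-intro : (f : Fin n → Bool) (i : Fin n) → T (f i) → T (anyᶠ f)
anyᶠ-intro f zero    fi = from T-∨ (inj₁ fi)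
anyᶠ-intro f (suc i) fi = from (T-∨ {f zero}) (inj₂ (anyᶠ-intro (f ∘ suc) i fi))

anyᶠ-elim : (f : Fin n → Bool) → T (anyᶠ f) → ∃[ i ] T (f i)
anyᶠ-elim {suc n} f t with to (T-∨ {f zero}) t
... | inj₁ f0 = zero , f0
... | inj₂ fs with anyᶠ-elim (f ∘ suc) fs
...   | i , fi = suc i , fi

allᶠ-elim : (f : Fin n → Bool) → T (allᶠ f) → ∀ i → T (f i)
allᶠ-elim f t zero    = proj₁ (to (T-∧ {f zero}) t)
allᶠ-elim f t (suc i) = allᶠ-elim (f ∘ suc) (proj₂ (to (T-∧ {f zero}) t)) i

-- The library's _≤?_ computes through the builtin _<ᵇ_, which makes the
-- exhaustive search below far slower; this decision works by pattern matching.
occupied? : (n : ℕ) → Dec (1 ≤ n)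
occupied? zero    = no λ ()
occupied? (suc _) = yes (s≤s z≤n)

guard-intro : ∀ {a} {A : Set a} (a? : Dec A) {b : Bool} → A → T b → T (⌊ a? ⌋ ∧ b)
guard-intro (yes _) _ tb = tb
guard-intro (no ¬a) a _  = ¬a a

guard-elim : ∀ {a} {A : Set a} (a? : Dec A) {b : Bool} → T (⌊ a? ⌋ ∧ b) → A × T b
guard-elim (yes a) tb = a , tb

allOfSize≤ : (n k : ℕ) → ((Fin n → ℕ) → Bool) → Bool
allOfSize≤ zero    k Q = Q []
allOfSize≤ (suc n) k Q = allᶠ {suc k} λ a → allOfSize≤ n (k ∸ toℕ a) λ r → Q (toℕ a ∷ r)

-- Distributions are functions, so the enumeration reaches p only up to ≗:
-- it reaches normalise p.
normalise : (Fin n → ℕ) → Fin n → ℕ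
normalise {zero}  p = []
normalise {suc n} p = head p ∷ normalise (tail p)

normalise-≗ : (p : Fin n → ℕ) → normalise p ≗ p
normalise-≗ p zero    = refl
normalise-≗ p (suc i) = normalise-≗ (tail p) i

allOfSize≤-normalise : (Q : (Fin n → ℕ) → Bool) → T (allOfSize≤ n k Q) →
                       (p : Fin n → ℕ) → size p ≤ k → T (Q (normalise p))
allOfSize≤-normalise {zero}  Q all p _ = all
allOfSize≤-normalise {suc n} {k} Q all p size≤k =
  allOfSize≤-normalise _ all-head (tail p)
    (subst (_≤ k ∸ head p) (m+n∸m≡n (head p) _) (∸-monoˡ-≤ (head p) size≤k))
  where
  head< : head p < suc k
  head< = s≤s (≤-trans (m≤m+n _ _) size≤k)
  all-head : T (allOfSize≤ n (k ∸ head p) λ r → Q (head p ∷ r))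
  all-head = subst (λ a → T (allOfSize≤ n (k ∸ a) λ r → Q (a ∷ r))) (toℕ-fromℕ< head<)
               (allᶠ-elim (λ a → allOfSize≤ n (k ∸ toℕ a) λ r → Q (toℕ a ∷ r)) all (fromℕ< head<))

module Search (G : Graph) (adj? : Decidable (Adj G)) where

  anyMove : Dist G → (Fin (order G) → Fin (order G) → Fin (order G) → Bool) → Bool
  anyMove p f =
    anyᶠ λ v → ⌊ occupied? (p v) ⌋ ∧ anyᶠ λ w → ⌊ occupied? (dec1 v p w) ⌋ ∧
    anyᶠ λ u → ⌊ adj? v u ⌋ ∧ ⌊ adj? w u ⌋ ∧ f v w u

  anyMove-intro : ∀ {p f u} (m : Move G p u) → T (f (Move.v m) (Move.w m) u) → T (anyMove p f)
  anyMove-intro {p} {u = u} (move v w v~u w~u pv pw) t =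
    anyᶠ-intro _ v (guard-intro (occupied? (p v)) pv (anyᶠ-intro _ w (guard-intro (occupied? (dec1 v p w)) pw
      (anyᶠ-intro _ u (guard-intro (adj? v u) v~u (guard-intro (adj? w u) w~u t))))))

  anyMove-elim : ∀ {p f} → T (anyMove p f) → ∃[ u ] Σ (Move G p u) λ m → T (f (Move.v m) (Move.w m) u)
  anyMove-elim {p} t =
    let v , t₁   = anyᶠ-elim _ t
        pv , t₂  = guard-elim (occupied? (p v)) t₁
        w , t₃   = anyᶠ-elim _ t₂
        pw , t₄  = guard-elim (occupied? (dec1 v p w)) t₃
        u , t₅   = anyᶠ-elim _ t₄
        v~u , t₆ = guard-elim (adj? v u) t₅
        w~u , t₇ = guard-elim (adj? w u) t₆
    in u , move v w v~u w~u pv pw , t₇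

  canReach : ℕ → Dist G → Fin (order G) → Bool
  canReach zero    p x = ⌊ occupied? (p x) ⌋
  canReach (suc k) p x = ⌊ occupied? (p x) ⌋ ∨ anyMove p λ v w u → canReach k (inc1 u (dec1 w (dec1 v p))) x

  canReach⇒reachable : ∀ k {p x} → T (canReach k p x) → Reachable G p x
  canReach⇒reachable zero    {p} {x} t = p , ε , toWitness {a? = occupied? (p x)} t
  canReach⇒reachable (suc k) {p} {x} t =
    [ (λ 1≤px → p , ε , toWitness {a? = occupied? (p x)} 1≤px) , later ] (to (T-∨ {⌊ occupied? (p x) ⌋}) t)
    where
    later : T (anyMove p λ v w u → canReach k (inc1 u (dec1 w (dec1 v p))) x) → Reachable G p x
    later t′ =
      let _ , m , t″ = anyMove-elim t′
          q , steps , 1≤qx = canReach⇒reachable k t″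
      in q , move-step m ◅ steps , 1≤qx

  -- A distribution of size k allows at most k moves, so depth k is exhaustive.
  steps⇒canReach : ∀ k {p q x} → size p ≤ k → Star (Step G) p q → 1 ≤ q x → T (canReach k p x)
  steps⇒canReach zero    {p} {x = x} _ ε 1≤px = fromWitness {a? = occupied? (p x)} 1≤px
  steps⇒canReach (suc k) {p} {x = x} _ ε 1≤px = from T-∨ (inj₁ (fromWitness {a? = occupied? (p x)} 1≤px))
  steps⇒canReach k size≤k (step ◅ steps) 1≤qx with step-move step
  steps⇒canReach zero size≤0 (step ◅ steps) 1≤qx | _ , m , refl =
    contradiction (≤-trans (Move-size≥2 m) size≤0) λ ()
  steps⇒canReach (suc k) {p} {x = x} size≤ (step ◅ steps) 1≤qx | _ , m , refl =
    from (T-∨ {⌊ occupied? (p x) ⌋}) (inj₂ (anyMove-intro m (steps⇒canReach k (step-size≤ step size≤) steps 1≤qx)))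

  -- Hypotheses of the form b ≡ true rather than T b: refl then checks them by
  -- plain evaluation, which is much cheaper here.
  search-solvable : ∀ k {p} → allᶠ (λ x → canReach k p x) ≡ true → Solvable G p
  search-solvable k all x = canReach⇒reachable k (allᶠ-elim _ (from T-≡ all) x)

  search-unsolvable : ∀ k → allOfSize≤ (order G) k (λ p → anyᶠ λ x → not (canReach k p x)) ≡ true →
                      ∀ p → size p ≤ k → ¬ Solvable G p
  search-unsolvable k all p size≤k solvable
    with anyᶠ-elim _ (allOfSize≤-normalise _ (from T-≡ all) p size≤k)
  ... | x , unreachable with solvable-resp-≗ (sym ∘ normalise-≗ p) solvable x
  ...   | _ , steps , 1≤qx =
          subst T (to T-not-≡ unreachable)
            (steps⇒canReach k (subst (_≤ k) (sym (size-cong (normalise-≗ p))) size≤k) steps 1≤qx)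

petersen-adj? : Decidable (Adj petersen)
petersen-adj? i j = (toℕ i , toℕ j) ∈? petersenEdges ⊎-dec (toℕ j , toℕ i) ∈? petersenEdges
  where open import Data.List.Membership.DecPropositional (≡-dec ℕ._≟_ ℕ._≟_) using (_∈?_)

open Search petersen petersen-adj?

optRubbling-petersen : OptRubblingNumber petersen 4
optRubbling-petersen =
  (pile zero 4 , refl , search-solvable 3 refl) ,
  λ p size<4 → search-unsolvable 3 refl p (s≤s⁻¹ size<4)

mainTheorem13 :
    (∀ (n : ℕ) → 2 ≤ n → OptRubblingNumber (complete n) 2) ×
    (∀ (n : ℕ) → 4 ≤ n → OptRubblingNumber (wheel n) 2) ×
    (∀ (m n : ℕ) → 3 ≤ m → 3 ≤ n → OptRubblingNumber (completeBipartite m n) 3) ×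
    OptRubblingNumber petersen 4
mainTheorem13 =
  optRubbling-complete ,
  (λ n 4≤n → optRubbling-wheel n (≤-trans (s≤s z≤n) 4≤n)) ,
  (λ { (suc (suc (suc m))) (suc (suc (suc n))) (s≤s (s≤s (s≤s _))) (s≤s (s≤s (s≤s _))) →
         optRubbling-completeBipartite m n }) ,
  optRubbling-petersen
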